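{- Let $n\ge10$ and $1\le t\le n/4$ be integers. Let $\pi\in\Sigma_n$ be a permutation that does not fix every element of $[t]$ (i.e., $\pi(i)\ne i$ for some $i\in[t]$). Let $\mathcal{G}_{t-1}$ be the set of permutations $\sigma\in\Sigma_n$ such that $\sigma(i)=i$ for all $i\in[t]$ and $|\sigma\cap\pi|=t-1$. Then $|\mathcal{G}_{t-1}|\ge\frac14 t^{ -t}(n-t)!$.
   Context: $\Sigma_n$ is the set of permutations of $[n]=\{1,\dots,n\}$, and $|\sigma\cap\pi|$ is the number of $x\in[n]$ with $\sigma(x)=\pi(x)$. -}

module Defs where

open import Data.Nat using (ℕ; _*_; _^_; _≤_; _<_; _∸_)
open import Data.Fin using (Fin; toℕ; _≟_)
open import Data.Fin.Permutation using (Permutation′; _⟨$⟩ʳ_)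
open import Data.List using (List; length; filter)
open import Data.List.Relation.Unary.All using (All)
open import Data.List.Relation.Unary.AllPairs using (AllPairs)
open import Data.Fin.Base using ()
open import Data.List using (allFin) public
open import Data.Product using (_×_; ∃)
open import Relation.Nullary using (¬_)
open import Relation.Binary.PropositionalEquality using (_≡_; _≢_)

-- Σ_n : permutations of [n], with [n] represented by Fin n (element i ↔ toℕ i + 1).

agreements : ∀ {n} → Permutation′ n → Permutation′ n → ℕ
agreements {n} σ π = length (filter (λ x → σ ⟨$⟩ʳ x ≟ π ⟨$⟩ʳ x) (allFin n))

-- x ∈ [t]  (0-indexed: toℕ x < t)
InFirst : ∀ {n} → ℕ → Fin n → Set
InFirst t x = toℕ x < t

_≈ₚ_ : ∀ {n} → Permutation′ n → Permutation′ n → Set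
σ ≈ₚ τ = ∀ x → σ ⟨$⟩ʳ x ≡ τ ⟨$⟩ʳ x

InG : ∀ {n} → ℕ → Permutation′ n → Permutation′ n → Set
InG t π σ = (∀ x → InFirst t x → σ ⟨$⟩ʳ x ≡ x) × (agreements σ π ≡ t ∸ 1)

-- "the set {σ ∈ Σ_n | P σ} has at least m elements":
-- there is a list of pairwise distinct (as elements of Σ_n) members of length m.
AtLeast : ∀ {n} → ℕ → (Permutation′ n → Set) → Set
AtLeast {n} m P = ∃ λ (L : List (Permutation′ n)) →
  All P L × AllPairs (λ σ τ → ¬ (σ ≈ₚ τ)) L × length L ≡ m

{-# OPTIONS --safe #-}
-- A permutation fixing [t] is id ⊕ ρ for a permutation ρ of the remaining M = n − t points, and
-- |σ ∩ π| = h + (agreements of ρ with the injection that π induces on the points it keeps outside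
-- [t]), where h < t counts the fixed points of π in [t]. That injection is defined on all but
-- z ≤ t − h of the M points, so we need many ρ with exactly k = t − 1 − h agreements with an
-- injection defined on d = M − z points. Fixing the value of ρ at one point at a time gives a
-- recurrence for their number, and a list of distinct such ρ realising it. Choosing the k agreeing
-- points gives C(d, k) times the number of permutations avoiding an injection on the other j = d − k
-- points, which is at least (j + z)!/3. Since z ≤ k + 1 and M ≥ 3t, z ≤ j, so C(M, k) ≤ 2^k C(d, k),
-- and 3 · 2^k · k! ≤ 4 t^t turns this into M! ≤ 4 t^t · |𝒢_{t−1}|.
module Submission where

open import Defs
open import Data.Nat using (ℕ; _*_; _^_; _≤_; _∸_; _!)
open import Data.Fin using (Fin; toℕ)
open import Data.Fin.Permutation using (Permutation′; _⟨$⟩ʳ_)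
open import Data.Product using (_×_; ∃)
open import Relation.Binary.PropositionalEquality using (_≢_)

open import Data.Bool using (Bool; true; false; not; _∧_; if_then_else_)
import Data.Bool as Bool
open import Data.Bool.Properties using (∧-zeroʳ; ∧-identityʳ; ¬-not)
open import Data.Empty using (⊥-elim)
open import Data.Fin using (zero; suc; punchIn; _≟_)
open import Data.Fin.Permutation
  using (_⟨$⟩ˡ_; inverseˡ; inverseʳ; _∘ₚ_; transpose; remove; insert; id; flip; punchIn-permute; insert-punchIn)
import Data.Fin.Permutation.Components as Components
open import Data.Fin.Properties using (punchInᵢ≢i; punchIn-injective; toℕ-injective; any?)
open import Data.List using (List; []; _∷_; map; concat; tabulate; length; filter)
open import Data.List.Properties using (length-++; length-map)
open import Data.List.Relation.Unary.All as All using (All; []; _∷_)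
import Data.List.Relation.Unary.All.Properties as All
open import Data.List.Relation.Unary.AllPairs as AllPairs using (AllPairs; []; _∷_)
import Data.List.Relation.Unary.AllPairs.Properties as AllPairs
open import Data.Nat hiding (_≟_)
open import Data.Nat.Properties hiding (_≟_)
open import Data.Nat.Tactic.RingSolver using (solve-∀)
open import Data.Product using (_,_)
open import Data.Sum using (_⊎_; inj₁; inj₂; [_,_]′)
open import Function using (_∘_)
open import Relation.Binary.PropositionalEquality
open import Relation.Nullary using (does; _because_; yes; no; ¬_)
open import Relation.Nullary.Decidable using (dec-true; dec-false)
open import Relation.Unary using (Pred; Decidable)
open import Algebra.Properties.Semiring.Sum +-*-semiring
  using (sum; sum-remove; sum-permute; ∑-distrib-+; sum-cong-≗)
open import Algebra.Properties.CommutativeSemigroup +-commutativeSemigroup using (interchange)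
open import Algebra.Properties.CommutativeSemigroup *-commutativeSemigroup using (x∙yz≈y∙xz)

-- Counting over Fin

bit : Bool → ℕ
bit true = 1
bit false = 0

bit≤1 : ∀ b → bit b ≤ 1
bit≤1 false = z≤n
bit≤1 true = ≤-refl

infix 4 _==_
_==_ : ∀ {m} → Fin m → Fin m → Bool
x == y = does (x ≟ y)

==-refl : ∀ {m} (x : Fin m) → (x == x) ≡ true
==-refl x = dec-true (x ≟ x) refl

==-≢ : ∀ {m} {x y : Fin m} → x ≢ y → (x == y) ≡ false
==-≢ {x = x} {y} = dec-false (x ≟ y)

==-injective : ∀ {m n} (h : Fin m → Fin n) → (∀ {a b} → h a ≡ h b → a ≡ b) →
  ∀ a b → (h a == h b) ≡ (a == b)
==-injective h h-inj a b with a ≟ b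
... | yes refl = ==-refl (h a)
... | no a≢b = ==-≢ (a≢b ∘ h-inj)

==-sym : ∀ {m} (x y : Fin m) → (x == y) ≡ (y == x)
==-sym x y with x ≟ y
... | yes refl = sym (==-refl x)
... | no x≢y = sym (==-≢ (x≢y ∘ sym))

count : ∀ {m} → (Fin m → Bool) → ℕ
count P = sum (bit ∘ P)

count-cong : ∀ {m} {P Q : Fin m → Bool} → (∀ x → P x ≡ Q x) → count P ≡ count Q
count-cong P≡Q = sum-cong-≗ (cong bit ∘ P≡Q)

∑-mono-≤ : ∀ {m} {f g : Fin m → ℕ} → (∀ x → f x ≤ g x) → sum f ≤ sum g
∑-mono-≤ {zero} f≤g = z≤n
∑-mono-≤ {suc m} f≤g = +-mono-≤ (f≤g zero) (∑-mono-≤ (f≤g ∘ suc))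

count-complement : ∀ {m} (P : Fin m → Bool) → count P + count (not ∘ P) ≡ m
count-complement {zero} P = refl
count-complement {suc m} P = begin
  bit (P zero) + count (P ∘ suc) + (bit (not (P zero)) + count (not ∘ P ∘ suc))
    ≡⟨ interchange (bit (P zero)) (count (P ∘ suc)) _ _ ⟩
  bit (P zero) + bit (not (P zero)) + (count (P ∘ suc) + count (not ∘ P ∘ suc))
    ≡⟨ cong₂ _+_ (bit+bit-not (P zero)) (count-complement (P ∘ suc)) ⟩
  suc m ∎
  where
  open ≡-Reasoning
  bit+bit-not : ∀ b → bit b + bit (not b) ≡ 1
  bit+bit-not true = refl
  bit+bit-not false = refl

count-remove : ∀ {m} (i : Fin (suc m)) (P : Fin (suc m) → Bool) →
  count P ≡ bit (P i) + count (P ∘ punchIn i)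
count-remove i P = sum-remove {i = i} (bit ∘ P)

count-permute : ∀ {m} (g : Permutation′ m) (P : Fin m → Bool) → count (P ∘ (g ⟨$⟩ʳ_)) ≡ count P
count-permute g P = sym (sum-permute (bit ∘ P) g)

count-false : ∀ {m} (P : Fin m → Bool) → (∀ x → P x ≡ false) → count P ≡ 0
count-false {zero} P all-false = refl
count-false {suc m} P all-false =
  cong₂ _+_ (cong bit (all-false zero)) (count-false (P ∘ suc) (all-false ∘ suc))

count-∧-== : ∀ {m} (P : Fin m → Bool) (v : Fin m) → count (λ y → P y ∧ (y == v)) ≡ bit (P v)
count-∧-== {suc m} P v = begin
  count (λ y → P y ∧ (y == v))
    ≡⟨ count-remove v (λ y → P y ∧ (y == v)) ⟩
  bit (P v ∧ (v == v)) + count (λ y → P (punchIn v y) ∧ (punchIn v y == v))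
    ≡⟨ cong₂ _+_ (cong (λ b → bit (P v ∧ b)) (==-refl v))
                 (count-false _ (λ y → trans (cong (P (punchIn v y) ∧_) (==-≢ (punchInᵢ≢i v y)))
                                             (∧-zeroʳ (P (punchIn v y))))) ⟩
  bit (P v ∧ true) + 0
    ≡⟨ trans (+-identityʳ _) (cong bit (∧-identityʳ (P v))) ⟩
  bit (P v) ∎
  where open ≡-Reasoning

count-split : ∀ {m} (P Q : Fin m → Bool) →
  count P ≡ count (λ x → P x ∧ Q x) + count (λ x → P x ∧ not (Q x))
count-split P Q =
  trans (sum-cong-≗ (λ x → split (P x) (Q x))) (∑-distrib-+ (λ x → bit (P x ∧ Q x)) (λ x → bit (P x ∧ not (Q x))))
  where
  split : ∀ a b → bit a ≡ bit (a ∧ b) + bit (a ∧ not b)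
  split false b = refl
  split true true = refl
  split true false = refl

∑-if : ∀ {m} (b : Fin m → Bool) (c d : ℕ) →
  sum (λ x → if b x then c else d) ≡ count b * c + count (not ∘ b) * d
∑-if {zero} b c d = refl
∑-if {suc m} b c d = begin
  (if b zero then c else d) + sum (λ x → if b (suc x) then c else d)
    ≡⟨ cong₂ _+_ (if≡ (b zero)) (∑-if (b ∘ suc) c d) ⟩
  (bit (b zero) * c + bit (not (b zero)) * d) + (count (b ∘ suc) * c + count (not ∘ b ∘ suc) * d)
    ≡⟨ interchange (bit (b zero) * c) _ _ _ ⟩
  (bit (b zero) * c + count (b ∘ suc) * c) + (bit (not (b zero)) * d + count (not ∘ b ∘ suc) * d)
    ≡⟨ cong₂ _+_ (*-distribʳ-+ c (bit (b zero)) _) (*-distribʳ-+ d (bit (not (b zero))) _) ⟨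
  count b * c + count (not ∘ b) * d ∎
  where
  open ≡-Reasoning
  if≡ : ∀ a → (if a then c else d) ≡ bit a * c + bit (not a) * d
  if≡ true = sym (trans (+-identityʳ _) (+-identityʳ c))
  if≡ false = sym (+-identityʳ d)

length-filter-tabulate : ∀ {m p} {A : Set} {P : Pred A p} (P? : Decidable P) (f : Fin m → A) →
  length (filter P? (tabulate f)) ≡ count (λ x → does (P? (f x)))
length-filter-tabulate {zero} P? f = refl
length-filter-tabulate {suc m} P? f with P? (f zero)
... | true because _ = cong suc (length-filter-tabulate P? (f ∘ suc))
... | false because _ = length-filter-tabulate P? (f ∘ suc)

count-∧-preimage : ∀ {m} (g : Permutation′ m) (P : Fin m → Bool) (v : Fin m) →
  count (λ x → P x ∧ (g ⟨$⟩ʳ x == v)) ≡ bit (P (g ⟨$⟩ˡ v))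
count-∧-preimage g P v = begin
  count (λ x → P x ∧ (g ⟨$⟩ʳ x == v))
    ≡⟨ count-permute (flip g) (λ x → P x ∧ (g ⟨$⟩ʳ x == v)) ⟨
  count (λ y → P (g ⟨$⟩ˡ y) ∧ (g ⟨$⟩ʳ (g ⟨$⟩ˡ y) == v))
    ≡⟨ count-cong (λ y → cong (λ w → P (g ⟨$⟩ˡ y) ∧ (w == v)) (inverseʳ g)) ⟩
  count (λ y → P (g ⟨$⟩ˡ y) ∧ (y == v))
    ≡⟨ count-∧-== (λ y → P (g ⟨$⟩ˡ y)) v ⟩
  bit (P (g ⟨$⟩ˡ v)) ∎
  where open ≡-Reasoning

count-true : ∀ {m} (P : Fin m → Bool) → (∀ x → P x ≡ true) → count P ≡ m
count-true P all-true = begin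
  count P                         ≡⟨ +-identityʳ (count P) ⟨
  count P + 0                     ≡⟨ cong (count P +_) (count-false (not ∘ P) (λ x → cong not (all-true x))) ⟨
  count P + count (not ∘ P)       ≡⟨ count-complement P ⟩
  _ ∎
  where open ≡-Reasoning

count-== : ∀ {m} (u : Fin m) → count (u ==_) ≡ 1
count-== u = begin
  count (u ==_)                 ≡⟨ count-cong (λ v → ==-sym u v) ⟩
  count (λ v → true ∧ (v == u)) ≡⟨ count-∧-== (λ _ → true) u ⟩
  1 ∎
  where open ≡-Reasoning

-- Agreement numbers

-- agreementNumber d z k is the number of permutations of a (d + z)-set that agree in exactly k
-- places with a fixed injection defined on d of its points. The clauses record the value σ p
-- at a pivot p: outside the domain while z > 0 (σ p lands in the image of the injection or not),
-- inside it when z = 0 (σ p agrees there or not).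
agreementNumber : ℕ → ℕ → ℕ → ℕ
agreementNumber zero zero zero = 1
agreementNumber zero zero (suc k) = 0
agreementNumber zero (suc z) k = suc z * agreementNumber zero z k
agreementNumber (suc d) (suc z) k =
  suc d * agreementNumber d (suc z) k + suc z * agreementNumber (suc d) z k
agreementNumber (suc zero) zero zero = 0
agreementNumber (suc zero) zero (suc k) = agreementNumber zero zero k
agreementNumber (suc (suc d)) zero zero = suc d * agreementNumber d 1 zero
agreementNumber (suc (suc d)) zero (suc k) =
  agreementNumber (suc d) zero k + suc d * agreementNumber d 1 (suc k)

agreementNumber-outside : ∀ d z k → agreementNumber d (suc z) k
  ≡ d * agreementNumber (d ∸ 1) (suc z) k + suc z * agreementNumber d z k
agreementNumber-outside zero z k = refl
agreementNumber-outside (suc d) z k = refl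

agreementNumber-total₀ : ∀ d → agreementNumber (suc d) zero zero ≡ d * agreementNumber (d ∸ 1) 1 zero
agreementNumber-total₀ zero = refl
agreementNumber-total₀ (suc d) = refl

agreementNumber-total : ∀ d k → agreementNumber (suc d) zero (suc k)
  ≡ agreementNumber d zero k + d * agreementNumber (d ∸ 1) 1 (suc k)
agreementNumber-total zero k = sym (+-identityʳ _)
agreementNumber-total (suc d) k = refl

rising : ℕ → ℕ → ℕ
rising j zero = 1
rising j (suc k) = (j + suc k) * rising j k

rising-suc : ∀ j k → suc j * rising (suc j) k ≡ (j + suc k) * rising j k
rising-suc j zero = cong (_* 1) (+-comm 1 j)
rising-suc j (suc k) = begin
  suc j * ((suc j + suc k) * rising (suc j) k)  ≡⟨ x∙yz≈y∙xz (suc j) (suc j + suc k) (rising (suc j) k) ⟩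
  (suc j + suc k) * (suc j * rising (suc j) k)  ≡⟨ cong₂ _*_ (sym (+-suc j (suc k))) (rising-suc j k) ⟩
  (j + suc (suc k)) * ((j + suc k) * rising j k) ∎
  where open ≡-Reasoning

rising-factorial : ∀ j k → j ! * rising j k ≡ (j + k) !
rising-factorial j zero = trans (*-identityʳ (j !)) (cong _! (sym (+-identityʳ j)))
rising-factorial j (suc k) = begin
  j ! * ((j + suc k) * rising j k)  ≡⟨ x∙yz≈y∙xz (j !) (j + suc k) (rising j k) ⟩
  (j + suc k) * (j ! * rising j k)  ≡⟨ cong₂ _*_ (+-suc j k) (rising-factorial j k) ⟩
  suc (j + k) * (j + k) !           ≡⟨ cong _! (+-suc j k) ⟨
  (j + suc k) !                     ∎
  where open ≡-Reasoning

rising-+-≤ : ∀ {j z} k → z ≤ j → rising (j + z) k ≤ 2 ^ k * rising j k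
rising-+-≤ zero z≤j = ≤-refl
rising-+-≤ {j} {z} (suc k) z≤j = begin
  (j + z + suc k) * rising (j + z) k     ≤⟨ *-mono-≤ factor (rising-+-≤ k z≤j) ⟩
  (2 * (j + suc k)) * (2 ^ k * rising j k) ≡⟨ [m*n]*[o*p]≡[m*o]*[n*p] 2 (j + suc k) (2 ^ k) (rising j k) ⟩
  (2 * 2 ^ k) * ((j + suc k) * rising j k) ∎
  where
  open ≤-Reasoning
  factor : j + z + suc k ≤ 2 * (j + suc k)
  factor = begin
    j + z + suc k       ≤⟨ +-monoˡ-≤ (suc k) (+-monoʳ-≤ j z≤j) ⟩
    j + j + suc k       ≤⟨ m≤m+n _ (suc k) ⟩
    j + j + suc k + suc k ≡⟨ double j (suc k) ⟩
    2 * (j + suc k)     ∎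
    where
    double : ∀ a b → a + a + b + b ≡ 2 * (a + b)
    double = solve-∀

rising-suc-suc : ∀ j k →
  suc (suc j) * (suc j * rising (suc (suc j)) k) ≡ suc (j + suc k) * rising j (suc k)
rising-suc-suc j k = begin
  suc (suc j) * (suc j * R₂)        ≡⟨ x∙yz≈y∙xz (suc (suc j)) (suc j) R₂ ⟩
  suc j * (suc (suc j) * R₂)        ≡⟨ cong (suc j *_) (rising-suc (suc j) k) ⟩
  suc j * ((suc j + suc k) * R₁)    ≡⟨ x∙yz≈y∙xz (suc j) (suc j + suc k) R₁ ⟩
  (suc j + suc k) * (suc j * R₁)    ≡⟨ cong ((suc j + suc k) *_) (rising-suc j k) ⟩
  suc (j + suc k) * rising j (suc k) ∎
  where
  open ≡-Reasoning
  R₁ = rising (suc j) k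
  R₂ = rising (suc (suc j)) k

private
  factorˡ : ∀ f a b x y → a * (f * x) + b * (f * y) ≡ f * (a * x + b * y)
  factorˡ = solve-∀

-- Choose which k of the j + k domain points agree; the rest of σ avoids the remaining j.
agreementNumber-choose : ∀ k j z →
  rising j k * agreementNumber j z 0 ≤ k ! * agreementNumber (j + k) z k
agreementNumber-choose zero j z =
  ≤-reflexive (cong (λ d → 1 * agreementNumber d z 0) (sym (+-identityʳ j)))
agreementNumber-choose (suc k) zero (suc z) = begin
  R * (suc z * N 0 z 0)        ≡⟨ x∙yz≈y∙xz R (suc z) (N 0 z 0) ⟩
  suc z * (R * N 0 z 0)        ≤⟨ *-monoʳ-≤ (suc z) (agreementNumber-choose (suc k) 0 z) ⟩
  suc z * (suc k ! * X)        ≡⟨ x∙yz≈y∙xz (suc z) (suc k !) X ⟩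
  suc k ! * (suc z * X)        ≤⟨ *-monoʳ-≤ (suc k !) (m≤n+m (suc z * X) (suc k * N k (suc z) (suc k))) ⟩
  suc k ! * N (suc k) (suc z) (suc k) ∎
  where
  open ≤-Reasoning
  N = agreementNumber
  R = rising 0 (suc k)
  X = N (suc k) z (suc k)
agreementNumber-choose (suc k) (suc j) (suc z) = begin
  R * (suc j * N j (suc z) 0 + suc z * N (suc j) z 0)
    ≡⟨ expand ⟩
  suc (j + suc k) * (rising j (suc k) * N j (suc z) 0) + suc z * (R * N (suc j) z 0)
    ≤⟨ +-mono-≤ (*-monoʳ-≤ (suc (j + suc k)) (agreementNumber-choose (suc k) j (suc z)))
                (*-monoʳ-≤ (suc z) (agreementNumber-choose (suc k) (suc j) z)) ⟩
  suc (j + suc k) * (suc k ! * X) + suc z * (suc k ! * Y)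
    ≡⟨ factorˡ (suc k !) (suc (j + suc k)) (suc z) X Y ⟩
  suc k ! * N (suc j + suc k) (suc z) (suc k) ∎
  where
  open ≤-Reasoning
  N = agreementNumber
  R = rising (suc j) (suc k)
  X = N (j + suc k) (suc z) (suc k)
  Y = N (suc j + suc k) z (suc k)
  expand : R * (suc j * N j (suc z) 0 + suc z * N (suc j) z 0)
         ≡ suc (j + suc k) * (rising j (suc k) * N j (suc z) 0) + suc z * (R * N (suc j) z 0)
  expand = begin-equality
    R * (suc j * N j (suc z) 0 + suc z * N (suc j) z 0)
      ≡⟨ shuffle R (suc j) (suc z) (N j (suc z) 0) (N (suc j) z 0) ⟩
    (suc j * R) * N j (suc z) 0 + suc z * (R * N (suc j) z 0)
      ≡⟨ cong (λ a → a * N j (suc z) 0 + suc z * (R * N (suc j) z 0))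
              (trans (rising-suc j (suc k)) (cong (_* rising j (suc k)) (+-suc j (suc k)))) ⟩
    (suc (j + suc k) * rising j (suc k)) * N j (suc z) 0 + suc z * (R * N (suc j) z 0)
      ≡⟨ cong (_+ suc z * (R * N (suc j) z 0)) (*-assoc (suc (j + suc k)) (rising j (suc k)) _) ⟩
    suc (j + suc k) * (rising j (suc k) * N j (suc z) 0) + suc z * (R * N (suc j) z 0) ∎
    where
    shuffle : ∀ r a b x y → r * (a * x + b * y) ≡ (a * r) * x + b * (r * y)
    shuffle = solve-∀
agreementNumber-choose (suc k) zero zero = begin
  (suc k * rising 0 k) * 1         ≡⟨ *-assoc (suc k) (rising 0 k) 1 ⟩
  suc k * (rising 0 k * 1)         ≤⟨ *-monoʳ-≤ (suc k) (agreementNumber-choose k 0 0) ⟩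
  suc k * (k ! * N k 0 k)          ≡⟨ *-assoc (suc k) (k !) (N k 0 k) ⟨
  suc k ! * N k 0 k                ≤⟨ *-monoʳ-≤ (suc k !) dropSecond ⟩
  suc k ! * N (suc k) 0 (suc k)    ∎
  where
  open ≤-Reasoning
  N = agreementNumber
  dropSecond : N k 0 k ≤ N (suc k) 0 (suc k)
  dropSecond = ≤-trans (m≤m+n _ _) (≤-reflexive (sym (agreementNumber-total k k)))
agreementNumber-choose (suc k) (suc zero) zero =
  ≤-trans (≤-reflexive (*-zeroʳ (rising 1 (suc k)))) z≤n
agreementNumber-choose (suc k) (suc (suc j)) zero = begin
  (suc (suc j) + suc k) * R * N (suc (suc j)) 0 0
    ≡⟨ split (suc (suc j)) (suc k) R (suc j) (N j 1 0) ⟩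
  suc k * (R * N (suc (suc j)) 0 0) + suc (suc j) * (suc j * R) * N j 1 0
    ≡⟨ cong (λ a → suc k * (R * N (suc (suc j)) 0 0) + a * N j 1 0) (rising-suc-suc j k) ⟩
  suc k * (R * N (suc (suc j)) 0 0) + suc (j + suc k) * rising j (suc k) * N j 1 0
    ≡⟨ cong (suc k * (R * N (suc (suc j)) 0 0) +_) (*-assoc (suc (j + suc k)) (rising j (suc k)) (N j 1 0)) ⟩
  suc k * (R * N (suc (suc j)) 0 0) + suc (j + suc k) * (rising j (suc k) * N j 1 0)
    ≤⟨ +-mono-≤ (*-monoʳ-≤ (suc k) (agreementNumber-choose k (suc (suc j)) 0))
                (*-monoʳ-≤ (suc (j + suc k)) (agreementNumber-choose (suc k) j 1)) ⟩
  suc k * (k ! * N (suc (suc j) + k) 0 k) + suc (j + suc k) * (suc k ! * Y)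
    ≡⟨ cong (λ d → suc k * (k ! * N (suc d) 0 k) + suc (j + suc k) * (suc k ! * Y)) (+-suc j k) ⟨
  suc k * (k ! * X) + suc (j + suc k) * (suc k ! * Y)
    ≡⟨ gather (suc k) (k !) (suc (j + suc k)) X Y ⟩
  suc k ! * N (suc (suc j) + suc k) 0 (suc k) ∎
  where
  open ≤-Reasoning
  N = agreementNumber
  R = rising (suc (suc j)) k
  X = N (suc (j + suc k)) 0 k
  Y = N (j + suc k) 1 (suc k)
  split : ∀ a b r c y → (a + b) * r * (c * y) ≡ b * (r * (c * y)) + a * (c * r) * y
  split = solve-∀
  gather : ∀ a f c x y → a * (f * x) + c * (a * f * y) ≡ a * f * (x + c * y)
  gather = solve-∀

-- (n + z)(n − 1)! for n ≥ 2; the values for n < 2 are the largest that keep noAgreementBound-≤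
-- true in the base cases.
noAgreementBound : ℕ → ℕ → ℕ
noAgreementBound zero z = 3
noAgreementBound (suc zero) z = 3 * z
noAgreementBound (suc (suc n)) z = (suc (suc n) + z) * suc n !

private
  noAgreementBound-all-outside : ∀ z →
    noAgreementBound (suc z) (suc z) ≤ suc z * noAgreementBound z z
  noAgreementBound-all-outside zero = ≤-refl
  noAgreementBound-all-outside (suc zero) = s≤s (s≤s (s≤s (s≤s z≤n)))
  noAgreementBound-all-outside (suc (suc n)) = ≤-reflexive (identity n (suc n !))
    where
    identity : ∀ n f → (3 + n + (3 + n)) * ((2 + n) * f) ≡ (3 + n) * ((2 + n + (2 + n)) * f)
    identity = solve-∀

  noAgreementBound-outside : ∀ j z → noAgreementBound (suc j + suc z) (suc z)
    ≤ suc j * noAgreementBound (j + suc z) (suc z) + suc z * noAgreementBound (suc j + z) z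
  noAgreementBound-outside j z rewrite +-suc j z = go j z
    where
    go : ∀ j z → noAgreementBound (2 + (j + z)) (suc z)
      ≤ suc j * noAgreementBound (suc (j + z)) (suc z) + suc z * noAgreementBound (suc (j + z)) z
    go zero zero = ≤-refl
    go (suc j) z = ≤-reflexive (identity j z (suc (j + z) !))
      where
      identity : ∀ j z f → (3 + (j + z) + suc z) * ((2 + (j + z)) * f)
        ≡ (2 + j) * ((2 + (j + z) + suc z) * f) + suc z * ((2 + (j + z) + z) * f)
      identity = solve-∀
    go zero (suc z) = ≤-reflexive (identity z (suc z !))
      where
      identity : ∀ z f → (3 + z + (2 + z)) * ((2 + z) * f)
        ≡ 1 * ((2 + z + (2 + z)) * f) + (2 + z) * ((2 + z + suc z) * f)
      identity = solve-∀

  noAgreementBound-total : ∀ j → noAgreementBound (2 + j + 0) 0 ≤ suc j * noAgreementBound (j + 1) 1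
  noAgreementBound-total j rewrite +-identityʳ j | +-comm j 1 = go j
    where
    go : ∀ j → noAgreementBound (2 + j) 0 ≤ suc j * noAgreementBound (suc j) 1
    go zero = s≤s (s≤s z≤n)
    go (suc j) = ≤-reflexive (identity j (suc j !))
      where
      identity : ∀ j f → (3 + j + 0) * ((2 + j) * f) ≡ (2 + j) * ((2 + j + 1) * f)
      identity = solve-∀

noAgreementBound-≤ : ∀ j z → noAgreementBound (j + z) z ≤ 3 * agreementNumber j z 0
noAgreementBound-≤ zero zero = ≤-refl
noAgreementBound-≤ zero (suc z) = begin
  noAgreementBound (suc z) (suc z)   ≤⟨ noAgreementBound-all-outside z ⟩
  suc z * noAgreementBound z z       ≤⟨ *-monoʳ-≤ (suc z) (noAgreementBound-≤ zero z) ⟩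
  suc z * (3 * agreementNumber 0 z 0) ≡⟨ x∙yz≈y∙xz (suc z) 3 (agreementNumber 0 z 0) ⟩
  3 * agreementNumber 0 (suc z) 0    ∎
  where open ≤-Reasoning
noAgreementBound-≤ (suc j) (suc z) = begin
  noAgreementBound (suc j + suc z) (suc z)
    ≤⟨ noAgreementBound-outside j z ⟩
  suc j * noAgreementBound (j + suc z) (suc z) + suc z * noAgreementBound (suc j + z) z
    ≤⟨ +-mono-≤ (*-monoʳ-≤ (suc j) (noAgreementBound-≤ j (suc z)))
                (*-monoʳ-≤ (suc z) (noAgreementBound-≤ (suc j) z)) ⟩
  suc j * (3 * agreementNumber j (suc z) 0) + suc z * (3 * agreementNumber (suc j) z 0)
    ≡⟨ factorˡ 3 (suc j) (suc z) (agreementNumber j (suc z) 0) (agreementNumber (suc j) z 0) ⟩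
  3 * agreementNumber (suc j) (suc z) 0 ∎
  where open ≤-Reasoning
noAgreementBound-≤ (suc zero) zero = z≤n
noAgreementBound-≤ (suc (suc j)) zero = begin
  noAgreementBound (2 + j + 0) 0       ≤⟨ noAgreementBound-total j ⟩
  suc j * noAgreementBound (j + 1) 1   ≤⟨ *-monoʳ-≤ (suc j) (noAgreementBound-≤ j 1) ⟩
  suc j * (3 * agreementNumber j 1 0)  ≡⟨ x∙yz≈y∙xz (suc j) 3 (agreementNumber j 1 0) ⟩
  3 * agreementNumber (2 + j) 0 0      ∎
  where open ≤-Reasoning

factorial-≤-noAgreementBound : ∀ n z → 2 ≤ n → n ! ≤ noAgreementBound n z
factorial-≤-noAgreementBound (suc (suc n)) z _ = *-monoˡ-≤ (suc n !) (m≤m+n (suc (suc n)) z)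
factorial-≤-noAgreementBound (suc zero) z (s≤s ())

a^[1+n]+[1+n]*a^n≤[1+a]^[1+n] : ∀ n a → a ^ suc n + suc n * a ^ n ≤ suc a ^ suc n
a^[1+n]+[1+n]*a^n≤[1+a]^[1+n] zero a = ≤-reflexive (identity a)
  where
  identity : ∀ a → a * 1 + 1 * 1 ≡ suc a * 1
  identity = solve-∀
a^[1+n]+[1+n]*a^n≤[1+a]^[1+n] (suc n) a = begin
  a * (a * a ^ n) + suc (suc n) * (a * a ^ n)
    ≤⟨ m≤m+n _ (suc n * a ^ n) ⟩
  a * (a * a ^ n) + suc (suc n) * (a * a ^ n) + suc n * a ^ n
    ≡⟨ identity a (a ^ n) n ⟩
  suc a * (a * a ^ n + suc n * a ^ n)
    ≤⟨ *-monoʳ-≤ (suc a) (a^[1+n]+[1+n]*a^n≤[1+a]^[1+n] n a) ⟩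
  suc a * suc a ^ suc n ∎
  where
  open ≤-Reasoning
  identity : ∀ a p n → a * (a * p) + suc (suc n) * (a * p) + suc n * p ≡ suc a * (a * p + suc n * p)
  identity = solve-∀

2^k*k!≤[1+k]^k : ∀ k → 2 ^ k * k ! ≤ suc k ^ k
2^k*k!≤[1+k]^k zero = ≤-refl
2^k*k!≤[1+k]^k (suc k) = begin
  (2 * 2 ^ k) * (suc k * k !)         ≡⟨ [m*n]*[o*p]≡[m*o]*[n*p] 2 (2 ^ k) (suc k) (k !) ⟩
  (2 * suc k) * (2 ^ k * k !)         ≤⟨ *-monoʳ-≤ (2 * suc k) (2^k*k!≤[1+k]^k k) ⟩
  (2 * suc k) * suc k ^ k             ≡⟨ identity (suc k) (suc k ^ k) ⟩
  suc k ^ suc k + suc k * suc k ^ k   ≤⟨ a^[1+n]+[1+n]*a^n≤[1+a]^[1+n] k (suc k) ⟩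
  suc (suc k) ^ suc k                 ∎
  where
  open ≤-Reasoning
  identity : ∀ a p → (2 * a) * p ≡ a * p + a * p
  identity = solve-∀

3*[2^k*k!]≤4*t^t : ∀ {k t} → k < t → 3 * (2 ^ k * k !) ≤ 4 * t ^ t
3*[2^k*k!]≤4*t^t {k} {t} k<t = begin
  3 * (2 ^ k * k !)   ≤⟨ *-mono-≤ (n≤1+n 3) (2^k*k!≤[1+k]^k k) ⟩
  4 * suc k ^ k       ≤⟨ *-monoʳ-≤ 4 (m≤n*m (suc k ^ k) (suc k)) ⟩
  4 * suc k ^ suc k   ≤⟨ *-monoʳ-≤ 4 (^-monoˡ-≤ (suc k) k<t) ⟩
  4 * t ^ suc k       ≤⟨ *-monoʳ-≤ 4 (^-monoʳ-≤ t {{>-nonZero (≤-trans (s≤s z≤n) k<t)}} k<t) ⟩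
  4 * t ^ t           ∎
  where open ≤-Reasoning

factorial-≤-agreementNumber′ : ∀ {t k j z} → k < t → z ≤ j → 2 ≤ j + z →
  (j + k + z) ! ≤ 4 * t ^ t * agreementNumber (j + k) z k
factorial-≤-agreementNumber′ {t} {k} {j} {z} k<t z≤j 2≤j+z =
  *-cancelˡ-≤ (3 * k !) {{m*n≢0 3 (k !) {{_}} {{k !≢0}}}} (begin
    3 * k ! * (j + k + z) !
      ≡⟨ cong (λ n → 3 * k ! * n !) (+-assoc j k z) ⟩
    3 * k ! * (j + (k + z)) !
      ≡⟨ cong (λ n → 3 * k ! * (j + n) !) (+-comm k z) ⟩
    3 * k ! * (j + (z + k)) !
      ≡⟨ cong (λ n → 3 * k ! * n !) (+-assoc j z k) ⟨
    3 * k ! * (j + z + k) !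
      ≡⟨ cong (3 * k ! *_) (rising-factorial (j + z) k) ⟨
    3 * k ! * ((j + z) ! * rising (j + z) k)
      ≤⟨ *-monoʳ-≤ (3 * k !) (*-monoʳ-≤ ((j + z) !) (rising-+-≤ k z≤j)) ⟩
    3 * k ! * ((j + z) ! * (2 ^ k * rising j k))
      ≡⟨ regroup (k !) ((j + z) !) (2 ^ k) (rising j k) ⟩
    3 * (2 ^ k * k !) * (rising j k * (j + z) !)
      ≤⟨ *-mono-≤ (3*[2^k*k!]≤4*t^t k<t)
                  (*-monoʳ-≤ (rising j k)
                    (≤-trans (factorial-≤-noAgreementBound (j + z) z 2≤j+z) (noAgreementBound-≤ j z))) ⟩
    4 * t ^ t * (rising j k * (3 * agreementNumber j z 0))
      ≡⟨ cong (4 * t ^ t *_) (x∙yz≈y∙xz (rising j k) 3 (agreementNumber j z 0)) ⟩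
    4 * t ^ t * (3 * (rising j k * agreementNumber j z 0))
      ≤⟨ *-monoʳ-≤ (4 * t ^ t) (*-monoʳ-≤ 3 (agreementNumber-choose k j z)) ⟩
    4 * t ^ t * (3 * (k ! * agreementNumber (j + k) z k))
      ≡⟨ x∙yz≈y∙xz (4 * t ^ t) 3 (k ! * agreementNumber (j + k) z k) ⟩
    3 * (4 * t ^ t * (k ! * agreementNumber (j + k) z k))
      ≡⟨ cong (3 *_) (x∙yz≈y∙xz (4 * t ^ t) (k !) (agreementNumber (j + k) z k)) ⟩
    3 * (k ! * (4 * t ^ t * agreementNumber (j + k) z k))
      ≡⟨ *-assoc 3 (k !) _ ⟨
    3 * k ! * (4 * t ^ t * agreementNumber (j + k) z k) ∎)
  where
  open ≤-Reasoning
  regroup : ∀ f g p r → 3 * f * (g * (p * r)) ≡ 3 * (p * f) * (r * g)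
  regroup = solve-∀

factorial-≤-agreementNumber : ∀ {t k d z} → k < t → z ≤ suc k → 3 * t ≤ d + z →
  (d + z) ! ≤ 4 * t ^ t * agreementNumber d z k
factorial-≤-agreementNumber {t} {k} {d} {z} k<t z≤1+k 3t≤d+z =
  subst (λ n → (n + z) ! ≤ 4 * t ^ t * agreementNumber n z k) (m∸n+n≡m k≤d)
    (factorial-≤-agreementNumber′ k<t (≤-trans z≤1+k (≤-trans (n≤1+n (suc k)) 2+k≤j))
      (≤-trans (≤-trans (s≤s (s≤s z≤n)) 2+k≤j) (m≤m+n (d ∸ k) z)))
  where
  open ≤-Reasoning
  2[1+k]≤d : suc k + suc k ≤ d
  2[1+k]≤d = +-cancelʳ-≤ (suc k) (suc k + suc k) d (begin
    suc k + suc k + suc k   ≡⟨ identity k ⟩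
    3 * suc k               ≤⟨ *-monoʳ-≤ 3 k<t ⟩
    3 * t                   ≤⟨ 3t≤d+z ⟩
    d + z                   ≤⟨ +-monoʳ-≤ d z≤1+k ⟩
    d + suc k               ∎)
    where
    identity : ∀ k → suc k + suc k + suc k ≡ 3 * suc k
    identity = solve-∀
  k≤d : k ≤ d
  k≤d = ≤-trans (n≤1+n k) (≤-trans (m≤m+n (suc k) (suc k)) 2[1+k]≤d)
  2+k≤j : suc (suc k) ≤ d ∸ k
  2+k≤j = subst (_≤ d ∸ k) (m+n∸m≡n k (suc (suc k)))
    (∸-monoˡ-≤ k (subst (_≤ d) (sym (+-suc k (suc k))) 2[1+k]≤d))

-- Partial injections

permute-injective : ∀ {m} (g : Permutation′ m) {a b} → g ⟨$⟩ʳ a ≡ g ⟨$⟩ʳ b → a ≡ b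
permute-injective g {a} {b} ga≡gb = trans (sym (inverseˡ g)) (trans (cong (g ⟨$⟩ˡ_) ga≡gb) (inverseˡ g))

transpose-at : ∀ {m} (i j : Fin m) → Components.transpose i j i ≡ j
transpose-at i j with i ≟ i
... | yes _ = refl
... | no i≢i = ⊥-elim (i≢i refl)

transpose-elsewhere : ∀ {m} {i j k : Fin m} → k ≢ i → k ≢ j → Components.transpose i j k ≡ k
transpose-elsewhere {i = i} {j} {k} k≢i k≢j with k ≟ i
... | yes k≡i = ⊥-elim (k≢i k≡i)
... | no _ with k ≟ j
... | yes k≡j = ⊥-elim (k≢j k≡j)
... | no _ = refl

insert-at : ∀ {m} (p v : Fin (suc m)) (ρ : Permutation′ m) → insert p v ρ ⟨$⟩ʳ p ≡ v
insert-at p v ρ with p ≟ p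
... | yes _ = refl
... | no p≢p = ⊥-elim (p≢p refl)

insert-cancel : ∀ {m} (p v : Fin (suc m)) {ρ τ : Permutation′ m} → insert p v ρ ≈ₚ insert p v τ → ρ ≈ₚ τ
insert-cancel p v {ρ} {τ} eq y = punchIn-injective v _ _ (begin
  punchIn v (ρ ⟨$⟩ʳ y)          ≡⟨ insert-punchIn p v ρ y ⟨
  insert p v ρ ⟨$⟩ʳ punchIn p y  ≡⟨ eq (punchIn p y) ⟩
  insert p v τ ⟨$⟩ʳ punchIn p y  ≡⟨ insert-punchIn p v τ y ⟩
  punchIn v (τ ⟨$⟩ʳ y)          ∎)
  where open ≡-Reasoning

-- An injection on the points where dom holds, presented as the restriction of a permutation.
record PartialInjection (m : ℕ) : Set where
  constructor _∣_
  field
    perm : Permutation′ m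
    dom  : Fin m → Bool

open PartialInjection

domSize : ∀ {m} → PartialInjection m → ℕ
domSize f = count (dom f)

outsideSize : ∀ {m} → PartialInjection m → ℕ
outsideSize f = count (not ∘ dom f)

agreementsWith : ∀ {m} → PartialInjection m → Permutation′ m → ℕ
agreementsWith f σ = count (λ x → dom f x ∧ (perm f ⟨$⟩ʳ x == σ ⟨$⟩ʳ x))

module _ {m} (f : PartialInjection (suc m)) (p v : Fin (suc m)) where

  private
    g = perm f ⟨$⟩ʳ_

  -- What remains of f once σ p = v is fixed. The transposition makes the permutation send p to v
  -- before p is removed; it changes perm f only at p and at the preimage of v, which leaves the domain.
  restrict : PartialInjection m
  restrict = remove p (perm f ∘ₚ transpose (g p) v)
           ∣ λ y → dom f (punchIn p y) ∧ not (g (punchIn p y) == v)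

  agreesAt : Bool
  agreesAt = dom f p ∧ (g p == v)

  restrict-punchIn : ∀ y → g (punchIn p y) ≢ v → g (punchIn p y) ≡ punchIn v (perm restrict ⟨$⟩ʳ y)
  restrict-punchIn y gx≢v = begin
    g x                                     ≡⟨ transpose-elsewhere gx≢gp gx≢v ⟨
    Components.transpose (g p) v (g x)      ≡⟨ punchIn-permute swapped p y ⟩
    punchIn (Components.transpose (g p) v (g p)) (perm restrict ⟨$⟩ʳ y)
                                            ≡⟨ cong (λ w → punchIn w (perm restrict ⟨$⟩ʳ y)) (transpose-at (g p) v) ⟩
    punchIn v (perm restrict ⟨$⟩ʳ y)        ∎
    where
    open ≡-Reasoning
    x = punchIn p y
    swapped = perm f ∘ₚ transpose (g p) v
    gx≢gp : g x ≢ g p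
    gx≢gp = punchInᵢ≢i p y ∘ permute-injective (perm f)

  agreementsWith-insert : ∀ ρ → agreementsWith f (insert p v ρ) ≡ bit agreesAt + agreementsWith restrict ρ
  agreementsWith-insert ρ = begin
    agreementsWith f (insert p v ρ)
      ≡⟨ count-remove p agreesAfter ⟩
    bit (dom f p ∧ (g p == insert p v ρ ⟨$⟩ʳ p)) + count (λ y → agreesAfter (punchIn p y))
      ≡⟨ cong₂ _+_ (cong (λ w → bit (dom f p ∧ (g p == w))) (insert-at p v ρ))
                   (count-cong pointwise) ⟩
    bit agreesAt + agreementsWith restrict ρ ∎
    where
    open ≡-Reasoning
    agreesAfter : Fin (suc m) → Bool
    agreesAfter x = dom f x ∧ (g x == insert p v ρ ⟨$⟩ʳ x)
    pointwise : ∀ y → agreesAfter (punchIn p y) ≡ (dom restrict y ∧ (perm restrict ⟨$⟩ʳ y == ρ ⟨$⟩ʳ y))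
    pointwise y rewrite insert-punchIn p v ρ y with g (punchIn p y) ≟ v
    ... | yes gx≡v = begin
      dom f (punchIn p y) ∧ (g (punchIn p y) == punchIn v (ρ ⟨$⟩ʳ y))
        ≡⟨ cong (dom f (punchIn p y) ∧_) (==-≢ (λ e → punchInᵢ≢i v (ρ ⟨$⟩ʳ y) (trans (sym e) gx≡v))) ⟩
      dom f (punchIn p y) ∧ false
        ≡⟨ ∧-zeroʳ (dom f (punchIn p y)) ⟩
      false
        ≡⟨ cong (_∧ (perm restrict ⟨$⟩ʳ y == ρ ⟨$⟩ʳ y)) (∧-zeroʳ (dom f (punchIn p y))) ⟨
      (dom f (punchIn p y) ∧ false) ∧ (perm restrict ⟨$⟩ʳ y == ρ ⟨$⟩ʳ y) ∎
    ... | no gx≢v = begin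
      dom f (punchIn p y) ∧ (g (punchIn p y) == punchIn v (ρ ⟨$⟩ʳ y))
        ≡⟨ cong (λ w → dom f (punchIn p y) ∧ (w == punchIn v (ρ ⟨$⟩ʳ y))) (restrict-punchIn y gx≢v) ⟩
      dom f (punchIn p y) ∧ (punchIn v (perm restrict ⟨$⟩ʳ y) == punchIn v (ρ ⟨$⟩ʳ y))
        ≡⟨ cong (dom f (punchIn p y) ∧_)
                (==-injective (punchIn v) (λ {a} {b} → punchIn-injective v a b) (perm restrict ⟨$⟩ʳ y) (ρ ⟨$⟩ʳ y)) ⟩
      dom f (punchIn p y) ∧ (perm restrict ⟨$⟩ʳ y == ρ ⟨$⟩ʳ y)
        ≡⟨ cong (_∧ (perm restrict ⟨$⟩ʳ y == ρ ⟨$⟩ʳ y)) (∧-identityʳ (dom f (punchIn p y))) ⟨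
      (dom f (punchIn p y) ∧ true) ∧ (perm restrict ⟨$⟩ʳ y == ρ ⟨$⟩ʳ y) ∎

  domSize-restrict : domSize f ≡ bit (dom f p ∧ not (g p == v)) + domSize restrict + bit (dom f (perm f ⟨$⟩ˡ v))
  domSize-restrict = begin
    count (dom f)
      ≡⟨ count-split (dom f) (λ x → g x == v) ⟩
    count (λ x → dom f x ∧ (g x == v)) + count (λ x → dom f x ∧ not (g x == v))
      ≡⟨ +-comm (count (λ x → dom f x ∧ (g x == v))) _ ⟩
    count (λ x → dom f x ∧ not (g x == v)) + count (λ x → dom f x ∧ (g x == v))
      ≡⟨ cong₂ _+_ (count-remove p (λ x → dom f x ∧ not (g x == v))) (count-∧-preimage (perm f) (dom f) v) ⟩
    bit (dom f p ∧ not (g p == v)) + domSize restrict + bit (dom f (perm f ⟨$⟩ˡ v)) ∎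
    where open ≡-Reasoning

  outsideSize-restrict : outsideSize restrict + bit agreesAt ≤ outsideSize f + 1
  outsideSize-restrict = +-cancelʳ-≤ (domSize f) _ _ (begin
    o′ + h + d                   ≡⟨ cong (o′ + h +_) domSize-restrict ⟩
    o′ + h + (a + d′ + c)        ≡⟨ regroup o′ h a d′ c ⟩
    (d′ + o′) + (a + h) + c      ≤⟨ +-mono-≤ (+-monoʳ-≤ (d′ + o′) (bit-split (dom f p) (g p == v))) (bit≤1 _) ⟩
    (d′ + o′) + 1 + 1            ≡⟨ cong (λ n → n + 1 + 1) (count-complement (dom restrict)) ⟩
    m + 1 + 1                    ≡⟨ identity m ⟩
    suc m + 1                    ≡⟨ cong (_+ 1) (count-complement (dom f)) ⟨
    d + o + 1                    ≡⟨ swap d o ⟩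
    o + 1 + d                    ∎)
    where
    open ≤-Reasoning
    d = domSize f
    o = outsideSize f
    d′ = domSize restrict
    o′ = outsideSize restrict
    a = bit (dom f p ∧ not (g p == v))
    h = bit agreesAt
    c = bit (dom f (perm f ⟨$⟩ˡ v))
    bit-split : ∀ b e → bit (b ∧ not e) + bit (b ∧ e) ≤ 1
    bit-split false e = z≤n
    bit-split true false = ≤-refl
    bit-split true true = ≤-refl
    regroup : ∀ o′ h a d′ c → o′ + h + (a + d′ + c) ≡ (d′ + o′) + (a + h) + c
    regroup = solve-∀
    identity : ∀ m → m + 1 + 1 ≡ suc m + 1
    identity = solve-∀
    swap : ∀ d o → d + o + 1 ≡ o + 1 + d
    swap = solve-∀

-- Permutations with a prescribed number of agreements

pivot : ∀ {m} → (Fin (suc m) → Bool) → Fin (suc m)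
pivot D with any? (λ x → D x Bool.≟ false)
... | yes (p , _) = p
... | no _ = zero

pivot-outside-or-total : ∀ {m} (D : Fin (suc m) → Bool) → D (pivot D) ≡ false ⊎ (∀ x → D x ≡ true)
pivot-outside-or-total D with any? (λ x → D x Bool.≟ false)
... | yes (_ , Dp≡false) = inj₁ Dp≡false
... | no ¬∃ = inj₂ (λ x → ¬-not (λ Dx≡false → ¬∃ (x , Dx≡false)))

remaining : ∀ {A : Set} → A → Bool → (ℕ → A) → ℕ → A
remaining a false f k = f k
remaining a true f zero = a
remaining a true f (suc k) = f k

remaining-elim : ∀ {A : Set} (Q : A → Set) {a b f k} →
  Q a → (∀ k′ → k ≡ bit b + k′ → Q (f k′)) → Q (remaining a b f k)
remaining-elim Q {b = false} Qa Qf = Qf _ refl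
remaining-elim Q {b = true} {k = zero} Qa Qf = Qa
remaining-elim Q {b = true} {k = suc k} Qa Qf = Qf k refl

extensions : ∀ {m} → (PartialInjection m → ℕ → List (Permutation′ m)) →
  PartialInjection (suc m) → Fin (suc m) → ℕ → Fin (suc m) → List (Permutation′ (suc m))
extensions L f p k v = map (insert p v) (remaining [] (agreesAt f p v) (L (restrict f p v)) k)

withAgreements : ∀ {m} → PartialInjection m → ℕ → List (Permutation′ m)
withAgreements {zero} f zero = id ∷ []
withAgreements {zero} f (suc k) = []
withAgreements {suc m} f k = concat (tabulate (extensions withAgreements f (pivot (dom f)) k))

extensions-at : ∀ {m} L (f : PartialInjection (suc m)) p k v → All (λ σ → σ ⟨$⟩ʳ p ≡ v) (extensions L f p k v)
extensions-at L f p k v = All.map⁺ (All.universal (λ ρ → insert-at p v ρ) _)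

withAgreements-agree : ∀ {m} (f : PartialInjection m) k → All (λ σ → agreementsWith f σ ≡ k) (withAgreements f k)
withAgreements-agree {zero} f zero = refl ∷ []
withAgreements-agree {zero} f (suc k) = []
withAgreements-agree {suc m} f k = All.concat⁺ (All.tabulate⁺ extension-agrees)
  where
  p = pivot (dom f)
  extension-agrees : ∀ v → All (λ σ → agreementsWith f σ ≡ k) (extensions withAgreements f p k v)
  extension-agrees v = All.map⁺ (remaining-elim (All _) [] λ k′ k≡ →
    All.map (λ {ρ} agree → trans (agreementsWith-insert f p v ρ) (trans (cong (bit (agreesAt f p v) +_) agree) (sym k≡)))
            (withAgreements-agree (restrict f p v) k′))

withAgreements-distinct : ∀ {m} (f : PartialInjection m) k → AllPairs (λ σ τ → ¬ σ ≈ₚ τ) (withAgreements f k)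
withAgreements-distinct {zero} f zero = [] ∷ []
withAgreements-distinct {zero} f (suc k) = []
withAgreements-distinct {suc m} f k =
  AllPairs.concat⁺ (All.tabulate⁺ extension-distinct) (AllPairs.tabulate⁺ extensions-apart)
  where
  p = pivot (dom f)
  extension-distinct : ∀ v → AllPairs (λ σ τ → ¬ σ ≈ₚ τ) (extensions withAgreements f p k v)
  extension-distinct v = AllPairs.map⁺ (AllPairs.map (λ ρ≉τ σ≈τ → ρ≉τ (insert-cancel p v σ≈τ))
    (remaining-elim (AllPairs _) {b = agreesAt f p v} {k = k} [] (λ k′ _ → withAgreements-distinct (restrict f p v) k′)))
  extensions-apart : ∀ {v w} → v ≢ w →
    All (λ σ → All (λ τ → ¬ σ ≈ₚ τ) (extensions withAgreements f p k w)) (extensions withAgreements f p k v)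
  extensions-apart {v} {w} v≢w = All.map (λ σp≡v → All.map (λ τp≡w σ≈τ → v≢w (trans (sym σp≡v) (trans (σ≈τ p) τp≡w)))
                                                      (extensions-at withAgreements f p k w))
                                         (extensions-at withAgreements f p k v)

length-concat-tabulate : ∀ {m} {A : Set} (F : Fin m → List A) → length (concat (tabulate F)) ≡ sum (length ∘ F)
length-concat-tabulate {zero} F = refl
length-concat-tabulate {suc m} F =
  trans (length-++ (F zero)) (cong (length (F zero) +_) (length-concat-tabulate (F ∘ suc)))

length-remaining : ∀ {A : Set} b (F : ℕ → List A) k → length (remaining [] b F k) ≡ remaining 0 b (length ∘ F) k
length-remaining false F k = refl
length-remaining true F zero = refl
length-remaining true F (suc k) = refl

remaining-mono-≤ : ∀ b {f g : ℕ → ℕ} → (∀ k → f k ≤ g k) → ∀ k → remaining 0 b f k ≤ remaining 0 b g k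
remaining-mono-≤ false f≤g k = f≤g k
remaining-mono-≤ true f≤g zero = z≤n
remaining-mono-≤ true f≤g (suc k) = f≤g k

module _ {m} (f : PartialInjection (suc m)) (p : Fin (suc m)) (k : ℕ) where

  private
    N = agreementNumber
    g = perm f ⟨$⟩ʳ_
    d = domSize f
    o = outsideSize f

  restrictNumber : Fin (suc m) → ℕ
  restrictNumber v = remaining 0 (agreesAt f p v) (N (domSize (restrict f p v)) (outsideSize (restrict f p v))) k

  private
    sizes-restrict : ∀ v → domSize (restrict f p v) + outsideSize (restrict f p v) ≡ m
    sizes-restrict v = count-complement (dom (restrict f p v))

  restrictNumber-outside : dom f p ≡ false → ∀ {o′} → d + o′ ≡ m →
    ∀ v c → dom f (perm f ⟨$⟩ˡ v) ≡ c → restrictNumber v ≡ (if c then N (d ∸ 1) (suc o′) k else N d o′ k)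
  restrictNumber-outside Dp≡false {o′} d+o′≡m v c bv≡c =
    trans (cong (λ a → remaining 0 a (N d′ o″) k) (cong (_∧ (g p == v)) Dp≡false)) (sizes c bv≡c)
    where
    d′ = domSize (restrict f p v)
    o″ = outsideSize (restrict f p v)
    d≡d′+c : ∀ {c} → dom f (perm f ⟨$⟩ˡ v) ≡ c → d ≡ d′ + bit c
    d≡d′+c bv≡c = trans (domSize-restrict f p v) (cong₂ (λ x y → bit (x ∧ not (g p == v)) + d′ + bit y) Dp≡false bv≡c)
    sizes : ∀ c → dom f (perm f ⟨$⟩ˡ v) ≡ c → N d′ o″ k ≡ (if c then N (d ∸ 1) (suc o′) k else N d o′ k)
    sizes true bv≡c = cong₂ (λ x y → N x y k) (sym (trans (cong (_∸ 1) d≡d′+1) (m+n∸n≡m d′ 1)))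
                            (+-cancelˡ-≡ d′ o″ (suc o′) (trans (sizes-restrict v) (sym d′+1+o′≡m)))
      where
      d≡d′+1 = d≡d′+c bv≡c
      d′+1+o′≡m : d′ + suc o′ ≡ m
      d′+1+o′≡m = trans (sym (+-assoc d′ 1 o′)) (trans (cong (_+ o′) (sym d≡d′+1)) d+o′≡m)
    sizes false bv≡c = cong₂ (λ x y → N x y k) d′≡d
      (+-cancelˡ-≡ d′ o″ o′ (trans (sizes-restrict v) (trans (sym d+o′≡m) (cong (_+ o′) (sym d′≡d)))))
      where
      d′≡d : d′ ≡ d
      d′≡d = sym (trans (d≡d′+c bv≡c) (+-identityʳ d′))

  ∑-restrictNumber-outside : dom f p ≡ false → sum restrictNumber ≡ N d o k
  ∑-restrictNumber-outside Dp≡false = begin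
    sum restrictNumber
      ≡⟨ sum-cong-≗ (λ v → restrictNumber-outside Dp≡false d+o′≡m v (b v) refl) ⟩
    sum (λ v → if b v then N (d ∸ 1) (suc o′) k else N d o′ k)
      ≡⟨ ∑-if b (N (d ∸ 1) (suc o′) k) (N d o′ k) ⟩
    count b * N (d ∸ 1) (suc o′) k + count (not ∘ b) * N d o′ k
      ≡⟨ cong₂ (λ a c → a * N (d ∸ 1) (suc o′) k + c * N d o′ k)
               (count-permute (flip (perm f)) (dom f)) (trans (count-permute (flip (perm f)) (not ∘ dom f)) o≡1+o′) ⟩
    d * N (d ∸ 1) (suc o′) k + suc o′ * N d o′ k
      ≡⟨ agreementNumber-outside d o′ k ⟨
    N d (suc o′) k
      ≡⟨ cong (λ n → N d n k) o≡1+o′ ⟨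
    N d o k ∎
    where
    open ≡-Reasoning
    b : Fin (suc m) → Bool
    b v = dom f (perm f ⟨$⟩ˡ v)
    o′ = count (not ∘ dom f ∘ punchIn p)
    o≡1+o′ : o ≡ suc o′
    o≡1+o′ = trans (count-remove p (not ∘ dom f)) (cong (λ c → bit (not c) + o′) Dp≡false)
    d+o′≡m : d + o′ ≡ m
    d+o′≡m = suc-injective (trans (sym (+-suc d o′)) (trans (cong (d +_) (sym o≡1+o′)) (count-complement (dom f))))

  restrictNumber-total : (∀ x → dom f x ≡ true) →
    ∀ v c → (g p == v) ≡ c → restrictNumber v ≡ (if c then remaining 0 true (N m 0) k else N (m ∸ 1) 1 k)
  restrictNumber-total total v c gp==v≡c =
    trans (cong (λ a → remaining 0 a (N d′ o″) k) (trans (cong (_∧ (g p == v)) (total p)) gp==v≡c)) (sizes c gp==v≡c)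
    where
    d′ = domSize (restrict f p v)
    o″ = outsideSize (restrict f p v)
    1+m≡ : ∀ {c} → (g p == v) ≡ c → suc m ≡ bit (not c) + d′ + 1
    1+m≡ {c} gp==v≡c = begin
      suc m
        ≡⟨ count-true (dom f) total ⟨
      d
        ≡⟨ domSize-restrict f p v ⟩
      bit (dom f p ∧ not (g p == v)) + d′ + bit (dom f (perm f ⟨$⟩ˡ v))
        ≡⟨ cong₂ (λ x y → bit (x ∧ not (g p == v)) + d′ + bit y) (total p) (total (perm f ⟨$⟩ˡ v)) ⟩
      bit (not (g p == v)) + d′ + 1
        ≡⟨ cong (λ c′ → bit (not c′) + d′ + 1) gp==v≡c ⟩
      bit (not c) + d′ + 1 ∎
      where open ≡-Reasoning
    sizes : ∀ c → (g p == v) ≡ c →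
      remaining 0 c (N d′ o″) k ≡ (if c then remaining 0 true (N m 0) k else N (m ∸ 1) 1 k)
    sizes true gp==v≡c = cong₂ (λ x y → remaining 0 true (N x y) k) d′≡m o″≡0
      where
      d′≡m : d′ ≡ m
      d′≡m = suc-injective (trans (+-comm 1 d′) (sym (1+m≡ gp==v≡c)))
      o″≡0 : o″ ≡ 0
      o″≡0 = +-cancelˡ-≡ d′ o″ 0 (trans (sizes-restrict v) (trans (sym d′≡m) (sym (+-identityʳ d′))))
    sizes false gp==v≡c = cong₂ (λ x y → N x y k) d′≡m-1 o″≡1
      where
      d′+1≡m : d′ + 1 ≡ m
      d′+1≡m = suc-injective (sym (1+m≡ gp==v≡c))
      d′≡m-1 : d′ ≡ m ∸ 1
      d′≡m-1 = sym (trans (cong (_∸ 1) (sym d′+1≡m)) (m+n∸n≡m d′ 1))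
      o″≡1 : o″ ≡ 1
      o″≡1 = +-cancelˡ-≡ d′ o″ 1 (trans (sizes-restrict v) (sym d′+1≡m))

  ∑-restrictNumber-total : (∀ x → dom f x ≡ true) → sum restrictNumber ≡ N d o k
  ∑-restrictNumber-total total = begin
    sum restrictNumber
      ≡⟨ sum-cong-≗ (λ v → restrictNumber-total total v (g p == v) refl) ⟩
    sum (λ v → if g p == v then R else B)
      ≡⟨ ∑-if (g p ==_) R B ⟩
    count (g p ==_) * R + count (not ∘ (g p ==_)) * B
      ≡⟨ cong₂ (λ a c → a * R + c * B) (count-== (g p)) others ⟩
    1 * R + m * B
      ≡⟨ pivot-step k ⟨
    N (suc m) 0 k
      ≡⟨ cong₂ (λ x y → N x y k) (count-true (dom f) total) (count-false (not ∘ dom f) (cong not ∘ total)) ⟨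
    N d o k ∎
    where
    open ≡-Reasoning
    R = remaining 0 true (N m 0) k
    B = N (m ∸ 1) 1 k
    pivot-step : ∀ k → N (suc m) 0 k ≡ 1 * remaining 0 true (N m 0) k + m * N (m ∸ 1) 1 k
    pivot-step zero = agreementNumber-total₀ m
    pivot-step (suc k) = trans (agreementNumber-total m k) (cong (_+ m * N (m ∸ 1) 1 (suc k)) (sym (*-identityˡ _)))
    others : count (not ∘ (g p ==_)) ≡ m
    others = suc-injective (trans (cong (_+ count (not ∘ (g p ==_))) (sym (count-== (g p)))) (count-complement (g p ==_)))

withAgreements-length : ∀ {m} (f : PartialInjection m) k →
  agreementNumber (domSize f) (outsideSize f) k ≤ length (withAgreements f k)
withAgreements-length {zero} f zero = ≤-refl
withAgreements-length {zero} f (suc k) = z≤n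
withAgreements-length {suc m} f k = begin
  agreementNumber (domSize f) (outsideSize f) k
    ≡⟨ [ ∑-restrictNumber-outside f p k , ∑-restrictNumber-total f p k ]′ (pivot-outside-or-total (dom f)) ⟨
  sum (restrictNumber f p k)
    ≤⟨ ∑-mono-≤ extension-length ⟩
  sum (length ∘ extensions withAgreements f p k)
    ≡⟨ length-concat-tabulate (extensions withAgreements f p k) ⟨
  length (withAgreements f k) ∎
  where
  open ≤-Reasoning
  p = pivot (dom f)
  extension-length : ∀ v → restrictNumber f p k v ≤ length (extensions withAgreements f p k v)
  extension-length v = begin
    remaining 0 a (agreementNumber (domSize r) (outsideSize r)) k
      ≤⟨ remaining-mono-≤ a (withAgreements-length r) k ⟩
    remaining 0 a (length ∘ withAgreements r) k
      ≡⟨ length-remaining a (withAgreements r) k ⟨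
    length (remaining [] a (withAgreements r) k)
      ≡⟨ length-map (insert p v) (remaining [] a (withAgreements r) k) ⟨
    length (extensions withAgreements f p k v) ∎
    where
    r = restrict f p v
    a = agreesAt f p v

-- Permutations fixing an initial segment

fixFirst : ∀ s {m} → Permutation′ m → Permutation′ (s + m)
fixFirst zero ρ = ρ
fixFirst (suc s) ρ = insert zero zero (fixFirst s ρ)

restrictFirst : ∀ s {m} → PartialInjection (s + m) → PartialInjection m
restrictFirst zero f = f
restrictFirst (suc s) f = restrictFirst s (restrict f zero zero)

agreementsFirst : ∀ s {m} → PartialInjection (s + m) → ℕ
agreementsFirst zero f = 0
agreementsFirst (suc s) f = bit (agreesAt f zero zero) + agreementsFirst s (restrict f zero zero)

fixFirst-fixes : ∀ s {m} (ρ : Permutation′ m) x → toℕ x < s → fixFirst s ρ ⟨$⟩ʳ x ≡ x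
fixFirst-fixes (suc s) ρ zero _ = insert-at zero zero (fixFirst s ρ)
fixFirst-fixes (suc s) ρ (suc y) (s≤s y<s) =
  trans (insert-punchIn zero zero (fixFirst s ρ) y) (cong suc (fixFirst-fixes s ρ y y<s))

fixFirst-cancel : ∀ s {m} {ρ τ : Permutation′ m} → fixFirst s ρ ≈ₚ fixFirst s τ → ρ ≈ₚ τ
fixFirst-cancel zero ρ≈τ = ρ≈τ
fixFirst-cancel (suc s) σ≈τ = fixFirst-cancel s (insert-cancel zero zero σ≈τ)

agreementsWith-fixFirst : ∀ s {m} (f : PartialInjection (s + m)) ρ →
  agreementsWith f (fixFirst s ρ) ≡ agreementsFirst s f + agreementsWith (restrictFirst s f) ρ
agreementsWith-fixFirst zero f ρ = refl
agreementsWith-fixFirst (suc s) f ρ = begin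
  agreementsWith f (insert zero zero (fixFirst s ρ))
    ≡⟨ agreementsWith-insert f zero zero (fixFirst s ρ) ⟩
  bit (agreesAt f zero zero) + agreementsWith (restrict f zero zero) (fixFirst s ρ)
    ≡⟨ cong (bit (agreesAt f zero zero) +_) (agreementsWith-fixFirst s (restrict f zero zero) ρ) ⟩
  bit (agreesAt f zero zero) + (agreementsFirst s (restrict f zero zero) + agreementsWith (restrictFirst (suc s) f) ρ)
    ≡⟨ +-assoc (bit (agreesAt f zero zero)) _ _ ⟨
  agreementsFirst (suc s) f + agreementsWith (restrictFirst (suc s) f) ρ ∎
  where open ≡-Reasoning

agreementsFirst-≤ : ∀ s {m} (f : PartialInjection (s + m)) → agreementsFirst s f ≤ s
agreementsFirst-≤ zero f = z≤n
agreementsFirst-≤ (suc s) f = +-mono-≤ (bit≤1 (agreesAt f zero zero)) (agreementsFirst-≤ s (restrict f zero zero))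

outsideSize-restrictFirst : ∀ s {m} (f : PartialInjection (s + m)) →
  outsideSize (restrictFirst s f) + agreementsFirst s f ≤ outsideSize f + s
outsideSize-restrictFirst zero f = ≤-refl
outsideSize-restrictFirst (suc s) f = begin
  o + (h + a)    ≡⟨ shuffle o h a ⟩
  (o + a) + h    ≤⟨ +-monoˡ-≤ h (outsideSize-restrictFirst s f′) ⟩
  (o′ + s) + h   ≡⟨ shuffle′ o′ s h ⟩
  (o′ + h) + s   ≤⟨ +-monoˡ-≤ s (outsideSize-restrict f zero zero) ⟩
  outsideSize f + 1 + s ≡⟨ +-assoc (outsideSize f) 1 s ⟩
  outsideSize f + suc s ∎
  where
  open ≤-Reasoning
  f′ = restrict f zero zero
  o = outsideSize (restrictFirst s f′)
  o′ = outsideSize f′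
  h = bit (agreesAt f zero zero)
  a = agreementsFirst s f′
  shuffle : ∀ o h a → o + (h + a) ≡ (o + a) + h
  shuffle o h a = trans (cong (o +_) (+-comm h a)) (sym (+-assoc o a h))
  shuffle′ : ∀ o s h → (o + s) + h ≡ (o + h) + s
  shuffle′ o s h = trans (+-assoc o s h) (trans (cong (o +_) (+-comm s h)) (sym (+-assoc o h s)))

module _ {n} (π : Permutation′ n) where

  Shifted : ∀ {m} → ℕ → PartialInjection m → Set
  Shifted i f = ∀ x y → toℕ x ≡ i + toℕ y → dom f y ≡ true → toℕ (π ⟨$⟩ʳ x) ≡ i + toℕ (perm f ⟨$⟩ʳ y)

  Shifted-initial : Shifted 0 (π ∣ λ _ → true)
  Shifted-initial x y x≡y _ = cong (λ w → toℕ (π ⟨$⟩ʳ w)) (toℕ-injective x≡y)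

  Shifted-restrict : ∀ {m i} (f : PartialInjection (suc m)) → Shifted i f → Shifted (suc i) (restrict f zero zero)
  -- In the omitted cases dom′y : false ≡ true.
  Shifted-restrict {i = i} f shifted x y x≡i+1+y dom′y with dom f (suc y) in dom-y | perm f ⟨$⟩ʳ suc y ≟ zero
  ... | true | no gy≢0 = begin
    toℕ (π ⟨$⟩ʳ x)                              ≡⟨ shifted x (suc y) (trans x≡i+1+y (sym (+-suc i (toℕ y)))) dom-y ⟩
    i + toℕ (perm f ⟨$⟩ʳ suc y)                 ≡⟨ cong (λ w → i + toℕ w) (restrict-punchIn f zero zero y gy≢0) ⟩
    i + suc (toℕ (perm (restrict f zero zero) ⟨$⟩ʳ y)) ≡⟨ +-suc i _ ⟩
    suc i + toℕ (perm (restrict f zero zero) ⟨$⟩ʳ y) ∎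
    where open ≡-Reasoning

  agreesAt-moved : ∀ {m i} (f : PartialInjection (suc m)) → Shifted i f →
    ∀ x → toℕ x ≡ i → π ⟨$⟩ʳ x ≢ x → agreesAt f zero zero ≡ false
  agreesAt-moved {i = i} f shifted x x≡i πx≢x with dom f zero in dom-0 | perm f ⟨$⟩ʳ zero ≟ zero
  ... | false | _ = refl
  ... | true | no _ = refl
  ... | true | yes g0≡0 = ⊥-elim (πx≢x (toℕ-injective (begin
    toℕ (π ⟨$⟩ʳ x)               ≡⟨ shifted x zero (trans x≡i (sym (+-identityʳ i))) dom-0 ⟩
    i + toℕ (perm f ⟨$⟩ʳ zero)   ≡⟨ cong (λ w → i + toℕ w) g0≡0 ⟩
    i + 0                        ≡⟨ +-identityʳ i ⟩
    i                            ≡⟨ x≡i ⟨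
    toℕ x                        ∎)))
    where open ≡-Reasoning

  agreementsFirst-< : ∀ s {m i} (f : PartialInjection (s + m)) → Shifted i f →
    (∃ λ x → i ≤ toℕ x × toℕ x < i + s × π ⟨$⟩ʳ x ≢ x) → agreementsFirst s f < s
  agreementsFirst-< zero {i = i} f shifted (x , i≤x , x<i+0 , _) =
    ⊥-elim (<-irrefl refl (≤-trans (subst (toℕ x <_) (+-identityʳ i) x<i+0) i≤x))
  agreementsFirst-< (suc s) {i = i} f shifted (x , i≤x , x<i+1+s , πx≢x) =
    s≤s ([ moved-later , moved-here ]′ (m≤n⇒m<n∨m≡n i≤x))
    where
    open ≤-Reasoning
    f′ = restrict f zero zero
    a = agreementsFirst s f′
    moved-here : i ≡ toℕ x → bit (agreesAt f zero zero) + a ≤ s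
    moved-here i≡x = begin
      bit (agreesAt f zero zero) + a   ≡⟨ cong (λ b → bit b + a) (agreesAt-moved f shifted x (sym i≡x) πx≢x) ⟩
      a                                ≤⟨ agreementsFirst-≤ s f′ ⟩
      s                                ∎
    moved-later : i < toℕ x → bit (agreesAt f zero zero) + a ≤ s
    moved-later i<x = begin
      bit (agreesAt f zero zero) + a   ≤⟨ +-monoˡ-≤ a (bit≤1 (agreesAt f zero zero)) ⟩
      suc a                            ≤⟨ agreementsFirst-< s f′ (Shifted-restrict f shifted)
                                            (x , i<x , subst (toℕ x <_) (+-suc i s) x<i+1+s , πx≢x) ⟩
      s                                ∎

agreements≡agreementsWith : ∀ {n} (σ π : Permutation′ n) → agreements σ π ≡ agreementsWith (π ∣ λ _ → true) σ
agreements≡agreementsWith σ π = trans (length-filter-tabulate (λ x → σ ⟨$⟩ʳ x ≟ π ⟨$⟩ʳ x) (λ x → x))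
                                      (count-cong (λ x → ==-sym (σ ⟨$⟩ʳ x) (π ⟨$⟩ʳ x)))

fixFirst-∈-𝒢 : ∀ t {M} (π : Permutation′ (t + M)) {ρ} →
  agreementsFirst t (π ∣ λ _ → true) + agreementsWith (restrictFirst t (π ∣ λ _ → true)) ρ ≡ t ∸ 1 →
  InG t π (fixFirst t ρ)
fixFirst-∈-𝒢 t π {ρ} agrees = fixFirst-fixes t ρ , (begin
  agreements (fixFirst t ρ) π                     ≡⟨ agreements≡agreementsWith (fixFirst t ρ) π ⟩
  agreementsWith (π ∣ λ _ → true) (fixFirst t ρ)  ≡⟨ agreementsWith-fixFirst t (π ∣ λ _ → true) ρ ⟩
  _                                               ≡⟨ agrees ⟩
  t ∸ 1                                           ∎)
  where open ≡-Reasoning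

𝒢-lower-bound : ∀ t M → 4 * t ≤ t + M → (π : Permutation′ (t + M)) →
  (∃ λ i → InFirst t i × π ⟨$⟩ʳ i ≢ i) → ∃ λ m → AtLeast m (InG t π) × (t + M ∸ t) ! ≤ 4 * t ^ t * m
𝒢-lower-bound t M 4t≤t+M π (i , i<t , πi≢i) =
  length L , (L , All.map⁺ (All.map in-𝒢 (withAgreements-agree f k)) , distinct , refl) , bound
  where
  f₀ = π ∣ λ _ → true
  f = restrictFirst t f₀
  h = agreementsFirst t f₀
  k = t ∸ suc h
  1+h+k≡t : suc h + k ≡ t
  1+h+k≡t = m+[n∸m]≡n (agreementsFirst-< π t f₀ (Shifted-initial π) (i , z≤n , i<t , πi≢i))
  L = map (fixFirst t) (withAgreements f k)
  in-𝒢 : ∀ {ρ} → agreementsWith f ρ ≡ k → InG t π (fixFirst t ρ)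
  in-𝒢 agrees = fixFirst-∈-𝒢 t π (trans (cong (h +_) agrees) (cong (_∸ 1) 1+h+k≡t))
  distinct = AllPairs.map⁺ (AllPairs.map (λ ρ≉τ σ≈τ → ρ≉τ (fixFirst-cancel t σ≈τ)) (withAgreements-distinct f k))
  d = domSize f
  z = outsideSize f
  M≡d+z : M ≡ d + z
  M≡d+z = sym (count-complement (dom f))
  z≤1+k : z ≤ suc k
  z≤1+k = +-cancelʳ-≤ h z (suc k) (begin
    z + h                  ≤⟨ outsideSize-restrictFirst t f₀ ⟩
    outsideSize f₀ + t     ≡⟨ cong (_+ t) (count-false {t + M} (λ _ → false) (λ _ → refl)) ⟩
    t                      ≡⟨ 1+h+k≡t ⟨
    suc h + k              ≡⟨ cong suc (+-comm h k) ⟩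
    suc k + h              ∎)
    where open ≤-Reasoning
  bound : (t + M ∸ t) ! ≤ 4 * t ^ t * length L
  bound = begin
    (t + M ∸ t) !                            ≡⟨ cong _! (trans (m+n∸m≡n t M) M≡d+z) ⟩
    (d + z) !                                ≤⟨ factorial-≤-agreementNumber k<t z≤1+k 3t≤d+z ⟩
    4 * t ^ t * agreementNumber d z k        ≤⟨ *-monoʳ-≤ (4 * t ^ t) (withAgreements-length f k) ⟩
    4 * t ^ t * length (withAgreements f k)  ≡⟨ cong (4 * t ^ t *_) (length-map (fixFirst t) (withAgreements f k)) ⟨
    4 * t ^ t * length L                     ∎
    where
    open ≤-Reasoning
    k<t = ≤-trans (s≤s (m≤n+m k h)) (≤-reflexive 1+h+k≡t)
    3t≤d+z = subst (3 * t ≤_) M≡d+z (+-cancelˡ-≤ t (3 * t) M 4t≤t+M)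

proposition1 : (n t : ℕ) → 10 ≤ n → 1 ≤ t → 4 * t ≤ n →
    (π : Permutation′ n) → (∃ λ (i : Fin n) → InFirst t i × π ⟨$⟩ʳ i ≢ i) →
    ∃ λ (m : ℕ) → AtLeast m (InG t π) × (n ∸ t) ! ≤ 4 * t ^ t * m
proposition1 n t _ _ 4t≤n =
  subst Bound t+[n∸t]≡n (𝒢-lower-bound t (n ∸ t) (subst (4 * t ≤_) (sym t+[n∸t]≡n) 4t≤n))
  where
  Bound : ℕ → Set
  Bound n′ = (π : Permutation′ n′) → (∃ λ i → InFirst t i × π ⟨$⟩ʳ i ≢ i) →
    ∃ λ m → AtLeast m (InG t π) × (n′ ∸ t) ! ≤ 4 * t ^ t * m
  t+[n∸t]≡n : t + (n ∸ t) ≡ n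
  t+[n∸t]≡n = m+[n∸m]≡n (≤-trans (m≤m+n t (3 * t)) 4t≤n)
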